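{- There is a formula $A$ of $\mathsf{LTL}^{\ll}$ such that for every formula $B$ of $\mathsf{LTL}$ we have $\mathcal{L}_A\neq\mathcal{L}_B$.
   Context: Fix a set $\mathsf{Prop}$ of atomic propositions. Formulas of $\mathsf{LTL}^{\ll}$ are built inductively: each $P\in\mathsf{Prop}$ is a formula; if $A,B$ are formulas then so are $\lnot A$, $A\land B$, $\mathsf{X}A$, $A \mathbin{\mathsf{U}} B$ and $A \mathbin{\ll} B$. Formulas of $\mathsf{LTL}$ (linear time temporal logic) are those built without the operator $\mathbin{\ll}$. A model $\sigma$ is an infinite sequence $\sigma_0\sigma_1\sigma_2\ldots$ of subsets of $\mathsf{Prop}$. Satisfaction $\sigma,i\models\cdot$ (for $i\in\mathbb{N}$) is defined by: $\sigma,i\models P$ iff $P\in\sigma_i$; $\sigma,i\models\lnot A$ iff not $\sigma,i\models A$; $\sigma,i\models A\land B$ iff both hold; $\sigma,i\models \mathsf{X}A$ iff $\sigma,i+1\models A$; $\sigma,i\models A\mathbin{\mathsf{U}}B$ iff there is $j\ge i$ with $\sigma,j\models B$ and $\sigma,k\models A$ for all $i\le k<j$; and $\sigma,i\models A\mathbin{\ll}B$ iff for every $b$ there exists $j$ such that $\mathsf{card}(A_\sigma^{i,j})+b\le \mathsf{card}(B_\sigma^{i,j})$, where $A_\sigma^{i,j}:=\{k\in\mathbb{N} : i\le k\le j \text{ and } \sigma,k\models A\}$ and $\mathsf{card}$ denotes cardinality. For a formula $A$ whose atomic propositions are $P_1,\ldots,P_n$, its language is the $\omega$-language over the alphabet $\Sigma:=2^{\{P_1,\ldots,P_n\}}$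 given by $\mathcal{L}_A:=\{\sigma\in\Sigma^\omega : \sigma,0\models A\}$. -}

module Defs where

open import Data.Nat using (ℕ; zero; suc; _+_; _≤_)
open import Data.Bool using (Bool; true)
open import Data.List using (List; []; _∷_; _++_)
open import Data.List.Membership.Propositional using (_∈_)
open import Data.Product using (Σ; _×_; ∃; ∃-syntax)
open import Relation.Binary.PropositionalEquality using (_≡_)
open import Relation.Nullary using (¬_)
open import Function.Bundles using (_⇔_)

Prop : Set
Prop = ℕ

data Formula : Set where
  atom : Prop → Formula
  ¬'_  : Formula → Formula
  _∧'_ : Formula → Formula → Formula
  X'_  : Formula → Formula
  _U'_ : Formula → Formula → Formula
  _≪_  : Formula → Formula → Formula

data IsLTL : Formula → Set where
  atom : ∀ p → IsLTL (atom p)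
  neg  : ∀ {A} → IsLTL A → IsLTL (¬' A)
  conj : ∀ {A B} → IsLTL A → IsLTL B → IsLTL (A ∧' B)
  next : ∀ {A} → IsLTL A → IsLTL (X' A)
  until : ∀ {A B} → IsLTL A → IsLTL B → IsLTL (A U' B)

Model : Set
Model = ℕ → Prop → Bool

-- CountFrom P i m n : exactly n positions k with i ≤ k < i + m satisfy P.
data CountFrom (P : ℕ → Set) (i : ℕ) : ℕ → ℕ → Set where
  c-zero : CountFrom P i zero zero
  c-yes  : ∀ {m n} → CountFrom P i m n → P (i + m) → CountFrom P i (suc m) (suc n)
  c-no   : ∀ {m n} → CountFrom P i m n → ¬ P (i + m) → CountFrom P i (suc m) n

-- card(P^{i,j}) = n, where P^{i,j} = {k : i ≤ k ≤ j, P k}.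
-- For j < i the set is empty.
data Card (P : ℕ → Set) (i j n : ℕ) : Set where
  card-ge : ∀ d → j ≡ i + d → CountFrom P i (suc d) n → Card P i j n
  card-lt : suc j ≤ i → n ≡ zero → Card P i j n

_,_⊨_ : Model → ℕ → Formula → Set
σ , i ⊨ atom p = σ i p ≡ true
σ , i ⊨ (¬' A) = ¬ (σ , i ⊨ A)
σ , i ⊨ (A ∧' B) = (σ , i ⊨ A) × (σ , i ⊨ B)
σ , i ⊨ (X' A) = σ , suc i ⊨ A
σ , i ⊨ (A U' B) = ∃[ j ] (i ≤ j × (σ , j ⊨ B) × (∀ k → i ≤ k → suc k ≤ j → σ , k ⊨ A))
σ , i ⊨ (A ≪ B) = ∀ (b : ℕ) → ∃[ j ] ∃[ na ] ∃[ nb ]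
   (Card (λ k → σ , k ⊨ A) i j na × Card (λ k → σ , k ⊨ B) i j nb × na + b ≤ nb)

atoms : Formula → List Prop
atoms (atom p) = p ∷ []
atoms (¬' A) = atoms A
atoms (A ∧' B) = atoms A ++ atoms B
atoms (X' A) = atoms A
atoms (A U' B) = atoms A ++ atoms B
atoms (A ≪ B) = atoms A ++ atoms B

-- L_A is a language over the alphabet
-- 2^{atoms A}; the two languages are equal iff the alphabets coincide and the
-- same words satisfy both formulas.  Since satisfaction only depends on the
-- atoms occurring in the formula, a word over 2^{atoms A} is represented by any
-- model extending it, so "same words" is "same models".
SameLanguage : Formula → Formula → Set
SameLanguage A B =
  (∀ p → (p ∈ atoms A) ⇔ (p ∈ atoms B)) × (∀ σ → (σ , 0 ⊨ A) ⇔ (σ , 0 ⊨ B))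

-- The formula ¬p ≪ p says that the p-positions outnumber the ¬p-positions
-- by arbitrarily large margins.  Take words made of alternating blocks of p
-- and ¬p.  If every block has length D + 1 the surplus of p never exceeds
-- D + 1; if the p-blocks have length D + 2 it grows by one in every period.
-- But no LTL formula whose X/U-nesting depth is at most D tells these two
-- words apart: in the Ehrenfeucht–Fraïssé game of D rounds, Duplicator keeps
-- the two positions in the same letter with equal remaining block lengths or
-- both at least the number of rounds left, answering Spoiler's until-moves by
-- stuttering inside a long block.

module Submission where

open import Defs
open import Data.Bool using (Bool; true; false; not; if_then_else_)
open import Data.Bool.Properties using (_≟_)
open import Data.Empty using (⊥-elim)
open import Data.Nat using (ℕ; zero; suc; _+_; _∸_; _≤_; _<_; _⊔_; _≤‴_; ≤‴-refl; ≤‴-step; s≤s)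
open import Data.Nat.Properties hiding (_≟_)
open import Data.Product using (∃-syntax; _×_; _,_; proj₁; proj₂)
open import Data.Sum using (inj₁; inj₂)
open import Function using (_∘_)
open import Function.Bundles using (_⇔_; mk⇔; Equivalence)
open import Relation.Binary.PropositionalEquality
open import Relation.Nullary using (¬_; does; yes; no; ¬?)
open import Relation.Unary using (Decidable)

depth : ∀ {A} → IsLTL A → ℕ
depth (atom p) = 0
depth (neg a) = depth a
depth (conj a b) = depth a ⊔ depth b
depth (next a) = suc (depth a)
depth (until a b) = suc (depth a ⊔ depth b)

UntilReply : (ℕ → ℕ → Set) → ℕ → ℕ → ℕ → Set
UntilReply Q i i′ j =
  ∃[ j′ ] (j ≤ j′ × Q i′ j′ × (∀ k → j ≤ k → k < j′ → ∃[ k′ ] (i ≤ k′ × k′ < i′ × Q k′ k)))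

module _ {Q : ℕ → ℕ → Set} where

  reply-refl : ∀ {i j} → Q i j → UntilReply Q i i j
  reply-refl q = _ , ≤-refl , q , λ k j≤k k<j → ⊥-elim (<⇒≱ k<j j≤k)

  reply-stepˡ : ∀ {i i′ j} → UntilReply Q (suc i) i′ j → UntilReply Q i i′ j
  reply-stepˡ (j′ , j≤j′ , q , back) = j′ , j≤j′ , q , λ k j≤k k<j′ →
    let k′ , i<k′ , k′<i′ , q′ = back k j≤k k<j′ in k′ , <⇒≤ i<k′ , k′<i′ , q′

  reply-stepʳ : ∀ {i i′ j} → Q i j → i < i′ → UntilReply Q i i′ (suc j) → UntilReply Q i i′ j
  reply-stepʳ {i} {i′} {j} q i<i′ (j′ , j<j′ , q′ , back) = j′ , <⇒≤ j<j′ , q′ , back′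
    where
    back′ : ∀ k → j ≤ k → k < j′ → ∃[ k′ ] (i ≤ k′ × k′ < i′ × Q k′ k)
    back′ k j≤k k<j′ with m≤n⇒m<n∨m≡n j≤k
    ... | inj₁ j<k = back k j<k k<j′
    ... | inj₂ refl = i , ≤-refl , i<i′ , q

  reply-step : ∀ {i i′ j} → Q i j → i < i′ → UntilReply Q (suc i) i′ (suc j) → UntilReply Q i i′ j
  reply-step q i<i′ = reply-stepʳ q i<i′ ∘ reply-stepˡ

record BackAndForth {W : Set} (word : W → Model) (R : ℕ → W → ℕ → W → ℕ → Set) : Set where
  field
    symmetric : ∀ {n w i v j} → R n w i v j → R n v j w i
    agree     : ∀ {n w i v j} → R n w i v j → word w i ≡ word v j
    advance   : ∀ {n w i v j} → R (suc n) w i v j → R n w (suc i) v (suc j)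
    reply     : ∀ {n w i v j i′} → R (suc n) w i v j → i ≤ i′ →
                UntilReply (λ k k′ → R n w k v k′) i i′ j

  transfer : ∀ {A n w i v j} (a : IsLTL A) → depth a ≤ n → R n w i v j →
             word w , i ⊨ A → word v , j ⊨ A
  transfer (atom p) _ r h = subst (λ x → x p ≡ true) (agree r) h
  transfer (neg a) d r h = λ h′ → h (transfer a d (symmetric r) h′)
  transfer (conj a b) d r (hA , hB) =
    transfer a (m⊔n≤o⇒m≤o (depth a) (depth b) d) r hA ,
    transfer b (m⊔n≤o⇒n≤o (depth a) (depth b) d) r hB
  transfer (next a) (s≤s d) r h = transfer a d (advance r) h
  transfer (until a b) (s≤s d) r (i′ , i≤i′ , hB , hA) with reply r i≤i′
  ... | j′ , j≤j′ , r′ , back =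
    j′ , j≤j′ , transfer b (m⊔n≤o⇒n≤o (depth a) (depth b) d) r′ hB , λ k j≤k k<j′ →
      let k′ , i≤k′ , k′<i′ , r″ = back k j≤k k<j′
      in transfer a (m⊔n≤o⇒m≤o (depth a) (depth b) d) r″ (hA k′ i≤k′ k′<i′)

count : {P : ℕ → Set} → Decidable P → ℕ → ℕ
count P? zero = zero
count P? (suc m) = if does (P? m) then suc (count P? m) else count P? m

count-CountFrom : ∀ {P} (P? : Decidable P) m → CountFrom P 0 m (count P? m)
count-CountFrom P? zero = c-zero
count-CountFrom P? (suc m) with P? m
... | yes p = c-yes (count-CountFrom P? m) p
... | no ¬p = c-no (count-CountFrom P? m) ¬p

CountFrom-unique : ∀ {P i m n n′} → CountFrom P i m n → CountFrom P i m n′ → n ≡ n′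
CountFrom-unique c-zero c-zero = refl
CountFrom-unique (c-yes c _) (c-yes c′ _) = cong suc (CountFrom-unique c c′)
CountFrom-unique (c-yes _ p) (c-no _ ¬p) = ⊥-elim (¬p p)
CountFrom-unique (c-no _ ¬p) (c-yes _ p) = ⊥-elim (¬p p)
CountFrom-unique (c-no c _) (c-no c′ _) = CountFrom-unique c c′

Card⇒CountFrom : ∀ {P j n} → Card P 0 j n → CountFrom P 0 (suc j) n
Card⇒CountFrom (card-ge d refl c) = c

≪-at-0 : ∀ {σ A B} (A? : Decidable (σ ,_⊨ A)) (B? : Decidable (σ ,_⊨ B)) →
         σ , 0 ⊨ (A ≪ B) ⇔ (∀ b → ∃[ j ] count A? (suc j) + b ≤ count B? (suc j))
≪-at-0 {σ} {A} {B} A? B? = mk⇔ to from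
  where
  Outpaced : Set
  Outpaced = ∀ b → ∃[ j ] count A? (suc j) + b ≤ count B? (suc j)
  to : σ , 0 ⊨ (A ≪ B) → Outpaced
  to h b with h b
  ... | j , na , nb , ca , cb , le =
    j , subst₂ (λ x y → x + b ≤ y)
          (CountFrom-unique (Card⇒CountFrom ca) (count-CountFrom A? (suc j)))
          (CountFrom-unique (Card⇒CountFrom cb) (count-CountFrom B? (suc j))) le
  from : Outpaced → σ , 0 ⊨ (A ≪ B)
  from h b with h b
  ... | j , le =
    j , count A? (suc j) , count B? (suc j) ,
    card-ge j refl (count-CountFrom A? (suc j)) , card-ge j refl (count-CountFrom B? (suc j)) , le

atom? : ∀ σ p → Decidable (σ ,_⊨ atom p)
atom? σ p k = σ k p ≟ true

-- (b , k): the current letter is b and k more positions of its block follow.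
State : Set
State = Bool × ℕ

BlockLengths : Set
BlockLengths = Bool → ℕ

step : BlockLengths → State → State
step l (b , suc k) = b , k
step l (b , zero) = not b , l (not b)

run : BlockLengths → ℕ → State
run l zero = true , l true
run l (suc i) = step l (run l i)

valuation : Bool → Prop → Bool
valuation b zero = b
valuation b (suc p) = false

-- The word (p^(l true + 1) (¬p)^(l false + 1))^ω with p = atom 0.
blockWord : BlockLengths → Model
blockWord l i = valuation (proj₁ (run l i))

LongBlocks : ℕ → BlockLengths → Set
LongBlocks n l = ∀ b → n ≤ l b

LongBlocks-weaken : ∀ {n l} → LongBlocks (suc n) l → LongBlocks n l
LongBlocks-weaken long b = <⇒≤ (long b)

data Close (n : ℕ) : State → State → Set where
  same : ∀ {s} → Close n s s
  long : ∀ {b} a a′ → Close n (b , a + n) (b , a′ + n)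

long≤ : ∀ {n b k k′} → n ≤ k → n ≤ k′ → Close n (b , k) (b , k′)
long≤ {n} {b} {k} {k′} p p′ =
  subst₂ (λ x y → Close n (b , x) (b , y)) (m∸n+n≡m p) (m∸n+n≡m p′) (long (k ∸ n) (k′ ∸ n))

Close-sym : ∀ {n s s′} → Close n s s′ → Close n s′ s
Close-sym same = same
Close-sym (long a a′) = long a′ a

Close-weaken : ∀ {n s s′} → Close (suc n) s s′ → Close n s s′
Close-weaken same = same
Close-weaken {n} (long a a′) rewrite +-suc a n | +-suc a′ n = long (suc a) (suc a′)

Close-letter : ∀ {n s s′} → Close n s s′ → proj₁ s ≡ proj₁ s′
Close-letter same = refl
Close-letter (long _ _) = refl

step-same : ∀ {n l₁ l₂} → LongBlocks n l₁ → LongBlocks n l₂ → ∀ s → Close n (step l₁ s) (step l₂ s)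
step-same long₁ long₂ (b , suc k) = same
step-same long₁ long₂ (b , zero) = long≤ (long₁ (not b)) (long₂ (not b))

step-Close : ∀ {n l₁ l₂ s s′} → LongBlocks n l₁ → LongBlocks n l₂ →
             Close (suc n) s s′ → Close n (step l₁ s) (step l₂ s′)
step-Close long₁ long₂ same = step-same long₁ long₂ _
step-Close long₁ long₂ (long zero zero) = same
step-Close long₁ long₂ (long (suc a) (suc a′)) = Close-weaken (long a a′)
step-Close {n} long₁ long₂ (long zero (suc a′)) = long≤ ≤-refl (<⇒≤ (m≤n+m (suc n) a′))
step-Close {n} long₁ long₂ (long (suc a) zero) = long≤ (<⇒≤ (m≤n+m (suc n) a)) ≤-refl

record Similar (n : ℕ) (l₁ : BlockLengths) (i : ℕ) (l₂ : BlockLengths) (j : ℕ) : Set where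
  constructor similar
  field
    longˡ : LongBlocks n l₁
    longʳ : LongBlocks n l₂
    close : Close n (run l₁ i) (run l₂ j)

module Chase {n l₁ l₂} (long₁ : LongBlocks (suc n) l₁) (long₂ : LongBlocks (suc n) l₂) where

  Similarⁿ : ℕ → ℕ → Set
  Similarⁿ i j = Similar n l₁ i l₂ j

  here : ∀ {i j s s′} → run l₁ i ≡ s → run l₂ j ≡ s′ → Close (suc n) s s′ → Similarⁿ i j
  here refl refl c = similar (LongBlocks-weaken long₁) (LongBlocks-weaken long₂) (Close-weaken c)

  -- chase-long exists for termination: when only j moves, it recurses on the offset a′.
  mutual
    chase : ∀ {i i′ j s s′} → i ≤‴ i′ → run l₁ i ≡ s → run l₂ j ≡ s′ → Close (suc n) s s′ →
            UntilReply Similarⁿ i i′ j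
    chase ≤‴-refl e₁ e₂ c = reply-refl (here e₁ e₂ c)
    chase (≤‴-step i<i′) e₁ e₂ same =
      reply-step (here e₁ e₂ same) (≤‴⇒≤ i<i′)
        (chase i<i′ (cong (step l₁) e₁) (cong (step l₂) e₂) (step-same long₁ long₂ _))
    chase (≤‴-step i<i′) e₁ e₂ (long a a′) = chase-long i<i′ a a′ e₁ e₂

    chase-long : ∀ {i i′ j b} → suc i ≤‴ i′ → ∀ a a′ →
                 run l₁ i ≡ (b , a + suc n) → run l₂ j ≡ (b , a′ + suc n) →
                 UntilReply Similarⁿ i i′ j
    chase-long i<i′ zero zero e₁ e₂ =
      reply-step (here e₁ e₂ same) (≤‴⇒≤ i<i′)
        (chase i<i′ (cong (step l₁) e₁) (cong (step l₂) e₂) same)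
    chase-long i<i′ (suc a) (suc a′) e₁ e₂ =
      reply-step (here e₁ e₂ (long (suc a) (suc a′))) (≤‴⇒≤ i<i′)
        (chase i<i′ (cong (step l₁) e₁) (cong (step l₂) e₂) (long a a′))
    chase-long i<i′ (suc a) zero e₁ e₂ =
      reply-stepˡ (chase i<i′ (cong (step l₁) e₁) e₂ (long a zero))
    chase-long i<i′ zero (suc a′) e₁ e₂ =
      reply-stepʳ (here e₁ e₂ (long zero (suc a′))) (≤‴⇒≤ i<i′)
        (chase-long i<i′ zero a′ e₁ (cong (step l₂) e₂))

blockWord-BackAndForth : BackAndForth blockWord Similar
blockWord-BackAndForth = record
  { symmetric = λ (similar long₁ long₂ c) → similar long₂ long₁ (Close-sym c)
  ; agree     = λ r → cong valuation (Close-letter (Similar.close r))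
  ; advance   = λ (similar long₁ long₂ c) →
      let long₁′ = LongBlocks-weaken long₁ ; long₂′ = LongBlocks-weaken long₂
      in similar long₁′ long₂′ (step-Close long₁′ long₂′ c)
  ; reply     = λ (similar long₁ long₂ c) i≤i′ → Chase.chase long₁ long₂ (≤⇒≤‴ i≤i′) refl refl c
  }

ones zeros : BlockLengths → ℕ → ℕ
ones l = count (atom? (blockWord l) 0)
zeros l = count (λ k → ¬? (atom? (blockWord l) 0 k))

counts : BlockLengths → ℕ → ℕ × ℕ
counts l m = ones l m , zeros l m

bump : Bool → ℕ → ℕ × ℕ → ℕ × ℕ
bump true t (x , y) = t + x , y
bump false t (x , y) = x , t + y

counts-suc : ∀ l m {b k} → run l m ≡ (b , k) → counts l (suc m) ≡ bump b 1 (counts l m)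
counts-suc l m {true} e rewrite e = refl
counts-suc l m {false} e rewrite e = refl

bump-suc : ∀ b t c → bump b 1 (bump b t c) ≡ bump b (suc t) c
bump-suc true t (x , y) = refl
bump-suc false t (x , y) = refl

walk : ∀ t {l m b k} → run l m ≡ (b , t + k) →
       run l (t + m) ≡ (b , k) × counts l (t + m) ≡ bump b t (counts l m)
walk zero {b = true} e = e , refl
walk zero {b = false} e = e , refl
walk (suc t) {l} {m} {b} {k} e with walk t (trans e (cong (b ,_) (sym (+-suc t k))))
... | e′ , c′ = cong (step l) e′ , (begin
  counts l (suc t + m)                 ≡⟨ counts-suc l (t + m) e′ ⟩
  bump b 1 (counts l (t + m))          ≡⟨ cong (bump b 1) c′ ⟩
  bump b 1 (bump b t (counts l m))     ≡⟨ bump-suc b t (counts l m) ⟩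
  bump b (suc t) (counts l m)          ∎)
  where open ≡-Reasoning

through-block : ∀ t {l m b} → run l m ≡ (b , t) →
                run l (suc t + m) ≡ (not b , l (not b)) ×
                counts l (suc t + m) ≡ bump b (suc t) (counts l m)
through-block t {l} {m} {b} e with walk t (trans e (cong (b ,_) (sym (+-identityʳ t))))
... | e′ , c′ =
  cong (step l) e′ ,
  trans (counts-suc l (t + m) e′) (trans (cong (bump b 1) c′) (bump-suc b t (counts l m)))

skewed : ℕ → BlockLengths
skewed D true = suc D
skewed D false = D

even : ℕ → BlockLengths
even D _ = D

skewed-surplus : ∀ D c → ∃[ m ] (run (skewed D) m ≡ (true , suc D) ×
                                 zeros (skewed D) m + c ≡ ones (skewed D) m)
skewed-surplus D zero = 0 , refl , refl
skewed-surplus D (suc c) with skewed-surplus D c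
... | m , e , h with through-block (suc D) e
... | e₁ , c₁ with through-block D e₁
... | e₂ , c₂ = m′ , e₂ , (begin
  zeros (skewed D) m′ + suc c         ≡⟨ cong (_+ suc c) (cong proj₂ counts′) ⟩
  suc D + zeros (skewed D) m + suc c  ≡⟨ +-suc (suc D + zeros (skewed D) m) c ⟩
  suc (suc D + zeros (skewed D) m + c) ≡⟨ cong suc (+-assoc (suc D) (zeros (skewed D) m) c) ⟩
  suc (suc D + (zeros (skewed D) m + c)) ≡⟨ cong (λ x → suc (suc D + x)) h ⟩
  suc (suc D + ones (skewed D) m)     ≡⟨ sym (cong proj₁ counts′) ⟩
  ones (skewed D) m′                  ∎)
  where
  open ≡-Reasoning
  m′ = suc D + (suc (suc D) + m)
  counts′ : counts (skewed D) m′ ≡ bump false (suc D) (bump true (suc (suc D)) (counts (skewed D) m))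
  counts′ = trans c₂ (cong (bump false (suc D)) c₁)

-- With x ones and y zeros before a position in state (b , k) of even D:
-- x − y is D − k inside a p-block and k + 1 inside a ¬p-block.
Balanced : ℕ → State → ℕ × ℕ → Set
Balanced D (true , k) (x , y) = x + k ≡ y + D
Balanced D (false , k) (x , y) = x ≡ y + suc k × k ≤ D

Balanced-step : ∀ {D} s c → Balanced D s c → Balanced D (step (even D) s) (bump (proj₁ s) 1 c)
Balanced-step (true , suc k) (x , y) h = trans (sym (+-suc x k)) h
Balanced-step {D} (true , zero) (x , y) h =
  trans (cong suc (trans (sym (+-identityʳ x)) h)) (sym (+-suc y D)) , ≤-refl
Balanced-step (false , suc k) (x , y) (h , k<D) = trans h (+-suc y (suc k)) , <⇒≤ k<D
Balanced-step {D} (false , zero) (x , y) (h , _) = cong (_+ D) (trans h (+-comm y 1))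

even-balanced : ∀ D m → Balanced D (run (even D) m) (counts (even D) m)
even-balanced D zero = refl
even-balanced D (suc m) =
  subst (Balanced D (run (even D) (suc m))) (sym (counts-suc (even D) m refl))
        (Balanced-step (run (even D) m) (counts (even D) m) (even-balanced D m))

Balanced-bounded : ∀ {D} s x y → Balanced D s (x , y) → x ≤ y + suc D
Balanced-bounded {D} (true , k) x y h = begin
  x          ≤⟨ m≤m+n x k ⟩
  x + k      ≡⟨ h ⟩
  y + D      ≤⟨ +-monoʳ-≤ y (n≤1+n D) ⟩
  y + suc D  ∎
  where open ≤-Reasoning
Balanced-bounded {D} (false , k) x y (h , k≤D) =
  subst (_≤ y + suc D) (sym h) (+-monoʳ-≤ y (s≤s k≤D))

unboundedSurplus : Formula
unboundedSurplus = (¬' atom 0) ≪ atom 0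

surplus-count : ∀ l → blockWord l , 0 ⊨ unboundedSurplus ⇔
                      (∀ c → ∃[ j ] zeros l (suc j) + c ≤ ones l (suc j))
surplus-count l =
  ≪-at-0 {blockWord l} {¬' atom 0} {atom 0} (λ k → ¬? (atom? (blockWord l) 0 k)) (atom? (blockWord l) 0)

skewed-satisfies : ∀ D → blockWord (skewed D) , 0 ⊨ unboundedSurplus
skewed-satisfies D = Equivalence.from (surplus-count (skewed D)) λ c →
  let m , e , h = skewed-surplus D c
      counts′ = counts-suc (skewed D) m e
  in m , subst₂ (λ x y → x + c ≤ y) (sym (cong proj₂ counts′)) (sym (cong proj₁ counts′))
                (m≤n⇒m≤1+n (≤-reflexive h))

even-refutes : ∀ D → ¬ (blockWord (even D) , 0 ⊨ unboundedSurplus)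
even-refutes D h =
  let j , surplus = Equivalence.to (surplus-count (even D)) h (suc (suc D))
      y = zeros (even D) (suc j)
  in <⇒≱ (+-monoʳ-< y (n<1+n (suc D)))
         (≤-trans surplus (Balanced-bounded (run (even D) (suc j)) (ones (even D) (suc j)) y
                                            (even-balanced D (suc j))))

skewed-longBlocks : ∀ D → LongBlocks D (skewed D)
skewed-longBlocks D true = n≤1+n D
skewed-longBlocks D false = ≤-refl

mainTheorem2 : ∃[ A ] (∀ B → IsLTL B → ¬ SameLanguage A B)
mainTheorem2 = unboundedSurplus , λ B b same →
  let D = depth b
      skewed⊨B = Equivalence.to (proj₂ same (blockWord (skewed D))) (skewed-satisfies D)
      even⊨B = BackAndForth.transfer blockWord-BackAndForth b ≤-refl
              (similar (skewed-longBlocks D) (λ _ → ≤-refl) (long 1 0)) skewed⊨B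
  in even-refutes D (Equivalence.from (proj₂ same (blockWord (even D))) even⊨B)
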